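{- Suppose that $f:\mathfrak A\to\mathfrak B$ is an element-total and element-surjective partial team isomorphism. Then there is an (ordinary) isomorphism $\pi:\mathfrak A\to\mathfrak B$ such that $f\subseteq\hat\pi$, where $\hat\pi(X)=\{\pi(\vec a):\vec a\in X\}$ for every relation $X$ on $\mathfrak A$.
   Context: For a structure $\mathfrak A$, $\mathcal R(\mathfrak A)=\bigcup_{n<\omega}\mathcal P(\mathfrak A^n)$. For $n$-ary $X$, $m$-ary $Y$: $X\times Y=\{\vec a\vec b:\vec a\in X,\vec b\in Y\}$; for $\vec\imath=(i_0,\dots,i_{m-1})\in n^{<\omega}$, $\mathrm{Pr}_{\vec\imath}(X)=\{(a_{i_0},\dots,a_{i_{m-1}}):\vec a\in X\}$; $\Delta_{\mathfrak A}=\{(a,a):a\in\mathfrak A\}$. For $\mathcal X\subseteq\mathcal R(\mathfrak A)$, $\mathrm{cl}(\mathcal X)$ is the least superset containing $\emptyset$, all $\mathfrak A^n$, $\Delta_{\mathfrak A}$, $R^{\mathfrak A}$ and the graphs $F^{\mathfrak A}$ of all relation and function symbols and $\{c^{\mathfrak A}\}$ for constants, closed under $\cap$, $\times$ and all $\mathrm{Pr}_{\vec\imath}$. A partial team map $f:\mathfrak A\to\mathfrak B$ is an arity-preserving partial function $\mathcal R(\mathfrak A)\to\mathcal R(\mathfrak B)$ with $\mathrm{dom}(f)=\mathrm{cl}(\mathrm{dom}(f))$, $\mathrm{ran}(f)=\mathrm{cl}(\mathrm{ran}(f))$. It is a partial team isomorphism if for all $X,Y\in\mathrm{dom}(f)$: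 $X=\emptyset$ iff $f(X)=\emptyset$ and $X=\mathfrak A^n$ iff $f(X)=\mathfrak B^n$; $X$ is a singleton iff $f(X)$ is; $f(X\times Y)=f(X)\times f(Y)$; $f(\mathrm{Pr}_{\vec\imath}(X))=\mathrm{Pr}_{\vec\imath}(f(X))$; $X\subseteq Y$ iff $f(X)\subseteq f(Y)$; and $f(\Delta_{\mathfrak A})=\Delta_{\mathfrak B}$, $f(R^{\mathfrak A})=R^{\mathfrak B}$ for relation/function symbols, $f(\{c^{\mathfrak A}\})=\{c^{\mathfrak B}\}$. It is element-total if $\{a\}\in\mathrm{dom}(f)$ for all $a\in\mathfrak A$, and element-surjective if $\{b\}\in\mathrm{ran}(f)$ for all $b\in\mathfrak B$. -}

module Defs where

open import Level using (Level)
open import Data.Nat using (ℕ; suc; _+_)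
open import Data.Fin using (Fin)
open import Data.Vec using (Vec; []; _∷_; _++_; map; lookup)
open import Data.Product using (Σ; _×_; _,_)
open import Data.Empty using (⊥)
open import Data.Unit using (⊤)
open import Relation.Binary.PropositionalEquality using (_≡_)
open import Function.Definitions using (Bijective)

record Signature : Set₁ where
  field
    RelSym   : Set
    relAr    : RelSym → ℕ
    FunSym   : Set
    funAr    : FunSym → ℕ
    ConstSym : Set

record Structure (σ : Signature) : Set₁ where
  open Signature σ
  field
    Carrier : Set
    rel     : (R : RelSym) → Vec Carrier (relAr R) → Set
    fun     : (F : FunSym) → Vec Carrier (funAr F) → Carrier
    const   : ConstSym → Carrier

NRel : Set → ℕ → Set₁
NRel A n = Vec A n → Set

_⊆ᵣ_ : ∀ {A n} → NRel A n → NRel A n → Set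
X ⊆ᵣ Y = ∀ v → X v → Y v

_≐_ : ∀ {A n} → NRel A n → NRel A n → Set
X ≐ Y = (X ⊆ᵣ Y) × (Y ⊆ᵣ X)

∅ᵣ : ∀ {A n} → NRel A n
∅ᵣ _ = ⊥

full : ∀ {A n} → NRel A n
full _ = ⊤

_∩ᵣ_ : ∀ {A n} → NRel A n → NRel A n → NRel A n
(X ∩ᵣ Y) v = X v × Y v

_⊗_ : ∀ {A n m} → NRel A n → NRel A m → NRel A (n + m)
(_⊗_ {A} {n} {m} X Y) v =
  Σ (Vec A n) λ a → Σ (Vec A m) λ b → (v ≡ a ++ b) × X a × Y b

Pr : ∀ {A n m} → Vec (Fin n) m → NRel A n → NRel A m
(Pr {A} {n} ι X) w = Σ (Vec A n) λ a → X a × (w ≡ map (lookup a) ι)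

Δ : ∀ {A} → NRel A 2
Δ (a ∷ b ∷ []) = a ≡ b

⟦_⟧ : ∀ {A n} → Vec A n → NRel A n
⟦ a ⟧ v = v ≡ a

IsSingleton : ∀ {A n} → NRel A n → Set
IsSingleton {A} {n} X = Σ (Vec A n) λ a → X ≐ ⟦ a ⟧

graph : ∀ {A k} → (Vec A k → A) → NRel A (k + 1)
graph {A} {k} F v = Σ (Vec A k) λ a → v ≡ a ++ (F a ∷ [])

Family : Set → Set₂
Family A = (n : ℕ) → NRel A n → Set₁

module _ {σ : Signature} (M : Structure σ) where
  open Signature σ
  open Structure M

  -- Cl M D n X : X ∈ cl(D) (X n-ary).  Sets are identified up to
  -- extensional equality (constructor cl-≐).
  data Cl (D : Family Carrier) : (n : ℕ) → NRel Carrier n → Set₁ where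
    cl-base  : ∀ {n X} → D n X → Cl D n X
    cl-≐     : ∀ {n X Y} → Cl D n X → X ≐ Y → Cl D n Y
    cl-∅     : ∀ {n} → Cl D n ∅ᵣ
    cl-full  : ∀ {n} → Cl D n full
    cl-Δ     : Cl D 2 Δ
    cl-rel   : (R : RelSym) → Cl D (relAr R) (rel R)
    cl-graph : (F : FunSym) → Cl D (funAr F + 1) (graph (fun F))
    cl-const : (c : ConstSym) → Cl D 1 ⟦ const c ∷ [] ⟧
    cl-∩     : ∀ {n X Y} → Cl D n X → Cl D n Y → Cl D n (X ∩ᵣ Y)
    cl-⊗     : ∀ {n m X Y} → Cl D n X → Cl D m Y → Cl D (n + m) (X ⊗ Y)
    cl-Pr    : ∀ {n m X} (ι : Vec (Fin n) m) → Cl D n X → Cl D m (Pr ι X)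

record PartialTeamMap {σ : Signature} (M N : Structure σ) : Set₂ where
  open Structure M renaming (Carrier to A)
  open Structure N renaming (Carrier to B)
  field
    dom : Family A
    app : ∀ {n} (X : NRel A n) → dom n X → NRel B n
    -- it is a function on sets (respects set equality)
    app-≐ : ∀ {n} {X Y : NRel A n} (p : dom n X) (q : dom n Y) →
            X ≐ Y → app X p ≐ app Y q

  ran : Family B
  ran n Y = Σ (NRel A n) λ X → Σ (dom n X) λ p → app X p ≐ Y

  field
    dom-cl : ∀ n X → Cl M dom n X → dom n X
    ran-cl : ∀ n Y → Cl N ran n Y → ran n Y

module _ {σ : Signature} {M N : Structure σ} (f : PartialTeamMap M N) where
  open Signature σ
  open Structure M renaming (Carrier to A; rel to relA; fun to funA; const to constA)
  open Structure N renaming (Carrier to B; rel to relB; fun to funB; const to constB)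
  open PartialTeamMap f

  record IsPartialTeamIso : Set₁ where
    field
      empty-iff  : ∀ {n} {X : NRel A n} (p : dom n X) →
                   (X ≐ ∅ᵣ → app X p ≐ ∅ᵣ) × (app X p ≐ ∅ᵣ → X ≐ ∅ᵣ)
      full-iff   : ∀ {n} {X : NRel A n} (p : dom n X) →
                   (X ≐ full → app X p ≐ full) × (app X p ≐ full → X ≐ full)
      single-iff : ∀ {n} {X : NRel A n} (p : dom n X) →
                   (IsSingleton X → IsSingleton (app X p)) ×
                   (IsSingleton (app X p) → IsSingleton X)
      pres-⊗     : ∀ {n m} {X : NRel A n} {Y : NRel A m}
                   (p : dom n X) (q : dom m Y) (r : dom (n + m) (X ⊗ Y)) →
                   app (X ⊗ Y) r ≐ (app X p ⊗ app Y q)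
      pres-Pr    : ∀ {n m} {X : NRel A n} (ι : Vec (Fin n) m)
                   (p : dom n X) (r : dom m (Pr ι X)) →
                   app (Pr ι X) r ≐ Pr ι (app X p)
      ⊆-iff      : ∀ {n} {X Y : NRel A n} (p : dom n X) (q : dom n Y) →
                   (X ⊆ᵣ Y → app X p ⊆ᵣ app Y q) × (app X p ⊆ᵣ app Y q → X ⊆ᵣ Y)
      pres-Δ     : (p : dom 2 Δ) → app Δ p ≐ Δ
      pres-rel   : (R : RelSym) (p : dom (relAr R) (relA R)) →
                   app (relA R) p ≐ relB R
      pres-graph : (F : FunSym) (p : dom (funAr F + 1) (graph (funA F))) →
                   app (graph (funA F)) p ≐ graph (funB F)
      pres-const : (c : ConstSym) (p : dom 1 ⟦ constA c ∷ [] ⟧) →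
                   app ⟦ constA c ∷ [] ⟧ p ≐ ⟦ constB c ∷ [] ⟧

  ElementTotal : Set₁
  ElementTotal = (a : A) → dom 1 ⟦ a ∷ [] ⟧

  ElementSurjective : Set₁
  ElementSurjective = (b : B) → ran 1 ⟦ b ∷ [] ⟧

module _ {σ : Signature} (M N : Structure σ) where
  open Signature σ
  open Structure M renaming (Carrier to A; rel to relA; fun to funA; const to constA)
  open Structure N renaming (Carrier to B; rel to relB; fun to funB; const to constB)

  record IsIsomorphism (π : A → B) : Set where
    field
      bijective : Bijective _≡_ _≡_ π
      pres-rel  : (R : RelSym) (a : Vec A (relAr R)) →
                  (relA R a → relB R (map π a)) × (relB R (map π a) → relA R a)
      pres-fun  : (F : FunSym) (a : Vec A (funAr F)) →
                  π (funA F a) ≡ funB F (map π a)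
      pres-const : (c : ConstSym) → π (constA c) ≡ constB c

hat : ∀ {A B : Set} → (A → B) → ∀ {n} → NRel A n → NRel B n
hat {A} π {n} X w = Σ (Vec A n) λ a → X a × (w ≡ map π a)

-- f ⊆ π̂ (as graphs): f(X) = π̂(X) for every X ∈ dom(f)
_⊆hat_ : ∀ {σ} {M N : Structure σ} → PartialTeamMap M N →
         (Structure.Carrier M → Structure.Carrier N) → Set₁
f ⊆hat π = ∀ n X (p : PartialTeamMap.dom f n X) →
           PartialTeamMap.app f X p ≐ hat π X

-- Element-totality and preservation of singletons give a map π with f{a} = {π a}.
-- As dom(f) is closed under products, f also sends every tuple singleton {ā}
-- to {π ā}, and since f preserves and reflects inclusion, π ā ∈ f(X) iff ā ∈ X.
-- Element-surjectivity makes π, hence π on tuples, surjective, so f(X) = π̂(X).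
-- Applied to the interpretations of the symbols, which f preserves, this makes
-- π an isomorphism.
{-# OPTIONS --safe #-}
module Submission where

open import Defs
open import Level using (0ℓ) renaming (suc to lsuc)
open import Data.Nat using (ℕ; suc)
open import Data.Product using (Σ; _×_; _,_; proj₁; proj₂)
open import Data.Vec using (Vec; []; _∷_; _++_; map)
open import Data.Vec.Properties using (∷-injective; ∷-injectiveˡ; ++-injective; map-++)
open import Data.Unit using (tt)
open import Function using (_∘_)
open import Function.Definitions using (Injective; StrictlySurjective; Bijective)
open import Function.Consequences.Propositional using (strictlySurjective⇒surjective)
open import Relation.Binary.Bundles using (Setoid)
open import Relation.Binary.PropositionalEquality using (_≡_; refl; sym; trans; cong₂; subst)
import Relation.Binary.Reasoning.Setoid as SetoidReasoning

module _ {A : Set} {n : ℕ} where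

  ≐-refl : {X : NRel A n} → X ≐ X
  ≐-refl = (λ _ x → x) , (λ _ x → x)

  ≐-sym : {X Y : NRel A n} → X ≐ Y → Y ≐ X
  ≐-sym (X⊆Y , Y⊆X) = Y⊆X , X⊆Y

  ≐-trans : {X Y Z : NRel A n} → X ≐ Y → Y ≐ Z → X ≐ Z
  ≐-trans (X⊆Y , Y⊆X) (Y⊆Z , Z⊆Y) = (λ v → Y⊆Z v ∘ X⊆Y v) , (λ v → Y⊆X v ∘ Z⊆Y v)

  ≐-setoid : Setoid (lsuc 0ℓ) 0ℓ
  ≐-setoid = record
    { Carrier       = NRel A n
    ; _≈_           = _≐_
    ; isEquivalence = record { refl = ≐-refl ; sym = ≐-sym ; trans = ≐-trans }
    }

⊗-cong : ∀ {A n m} {X X′ : NRel A n} {Y Y′ : NRel A m} →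
         X ≐ X′ → Y ≐ Y′ → (X ⊗ Y) ≐ (X′ ⊗ Y′)
⊗-cong (X⊆X′ , X′⊆X) (Y⊆Y′ , Y′⊆Y) =
  (λ { _ (a , b , refl , Xa , Yb) → a , b , refl , X⊆X′ a Xa , Y⊆Y′ b Yb }) ,
  (λ { _ (a , b , refl , Xa , Yb) → a , b , refl , X′⊆X a Xa , Y′⊆Y b Yb })

module _ {A : Set} where

  ∈⇒⟦⟧⊆ : ∀ {n} {X : NRel A n} {a} → X a → ⟦ a ⟧ ⊆ᵣ X
  ∈⇒⟦⟧⊆ Xa _ refl = Xa

  full≐⟦[]⟧ : full ≐ ⟦ [] {A = A} ⟧
  full≐⟦[]⟧ = (λ { [] _ → refl }) , (λ _ _ → tt)

  ⟦⟧-++ : ∀ {n m} (a : Vec A n) (b : Vec A m) → (⟦ a ⟧ ⊗ ⟦ b ⟧) ≐ ⟦ a ++ b ⟧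
  ⟦⟧-++ a b = (λ { _ (_ , _ , refl , refl , refl) → refl }) ,
              (λ { _ refl → a , b , refl , refl , refl })

module _ {A B : Set} {f : A → B} where

  map-injective : ∀ {n} → Injective _≡_ _≡_ f → Injective _≡_ _≡_ (map {n = n} f)
  map-injective f-inj {[]}     {[]}     _  = refl
  map-injective f-inj {x ∷ xs} {y ∷ ys} eq =
    let fx≡fy , fxs≡fys = ∷-injective eq
    in  cong₂ _∷_ (f-inj fx≡fy) (map-injective f-inj fxs≡fys)

  map-strictlySurjective : ∀ {n} → StrictlySurjective _≡_ f →
                           StrictlySurjective _≡_ (map {n = n} f)
  map-strictlySurjective f-surj []       = [] , refl
  map-strictlySurjective f-surj (y ∷ ys)
    with f-surj y | map-strictlySurjective f-surj ys
  ... | x , refl | xs , refl = x ∷ xs , refl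

module _ {A B : Set} (π : A → B) where

  hat-reflects : ∀ {n} {X : NRel A n} {a} → Injective _≡_ _≡_ π →
                 hat π X (map π a) → X a
  hat-reflects {X = X} π-inj (a′ , Xa′ , πa≡πa′) =
    subst X (sym (map-injective π-inj πa≡πa′)) Xa′

  hat-⟦⟧⊆ : ∀ {n} {a : Vec A n} {b} → hat π ⟦ a ⟧ ⊆ᵣ ⟦ b ⟧ → map π a ≡ b
  hat-⟦⟧⊆ {a = a} h = h (map π a) (a , refl , refl)

  hat-graph⊆ : ∀ {k} {F : Vec A k → A} {G : Vec B k → B} →
               hat π (graph F) ⊆ᵣ graph G → ∀ a → π (F a) ≡ G (map π a)
  hat-graph⊆ {F = F} h a
    with h (map π (a ++ F a ∷ [])) (a ++ F a ∷ [] , (a , refl) , refl)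
  ... | b , eq with ++-injective (map π a) b (trans (sym (map-++ π a (F a ∷ []))) eq)
  ... | refl , πFa≡Gb = ∷-injectiveˡ πFa≡Gb

module _ {σ : Signature} (M N : Structure σ) where
  open Signature σ
  open Structure M renaming (Carrier to A; rel to relA; fun to funA; const to constA)
  open Structure N renaming (Carrier to B; rel to relB; fun to funB; const to constB)

  hat-isomorphism : {π : A → B} → Bijective _≡_ _≡_ π →
                    (∀ R → hat π (relA R) ≐ relB R) →
                    (∀ F → hat π (graph (funA F)) ≐ graph (funB F)) →
                    (∀ c → hat π ⟦ constA c ∷ [] ⟧ ≐ ⟦ constB c ∷ [] ⟧) →
                    IsIsomorphism M N π
  hat-isomorphism {π} π-bij rel≐ graph≐ const≐ = record
    { bijective  = π-bij
    ; pres-rel   = λ R a →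
        (λ Ra → proj₁ (rel≐ R) (map π a) (a , Ra , refl)) ,
        (hat-reflects π (proj₁ π-bij) ∘ proj₂ (rel≐ R) (map π a))
    ; pres-fun   = λ F → hat-graph⊆ π (proj₁ (graph≐ F))
    ; pres-const = λ c → ∷-injectiveˡ (hat-⟦⟧⊆ π (proj₁ (const≐ c)))
    }

module _ {σ : Signature} {M N : Structure σ} (f : PartialTeamMap M N) where
  open Structure M renaming (Carrier to A)
  open Structure N renaming (Carrier to B)
  open PartialTeamMap f

  module _ (tot : ElementTotal f) where

    ⟦⟧∈dom : ∀ {n} (a : Vec A n) → dom n ⟦ a ⟧
    ⟦⟧∈dom []       = dom-cl _ _ (cl-≐ cl-full full≐⟦[]⟧)
    ⟦⟧∈dom (a ∷ as) =
      dom-cl _ _ (cl-≐ (cl-⊗ (cl-base (tot a)) (cl-base (⟦⟧∈dom as))) (⟦⟧-++ (a ∷ []) as))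

    module _ (iso : IsPartialTeamIso f) where
      open IsPartialTeamIso iso

      app-⟦⟧-singleton : ∀ a → IsSingleton (app ⟦ a ∷ [] ⟧ (tot a))
      app-⟦⟧-singleton a = proj₁ (single-iff (tot a)) (a ∷ [] , ≐-refl)

      π : A → B
      π a with app-⟦⟧-singleton a
      ... | b ∷ [] , _ = b

      π-spec : ∀ a → app ⟦ a ∷ [] ⟧ (tot a) ≐ ⟦ π a ∷ [] ⟧
      π-spec a with app-⟦⟧-singleton a
      ... | b ∷ [] , f⟦a⟧≐⟦b⟧ = f⟦a⟧≐⟦b⟧

      app-⟦⟧ : ∀ {n} (a : Vec A n) (p : dom n ⟦ a ⟧) → app ⟦ a ⟧ p ≐ ⟦ map π a ⟧
      app-⟦⟧ []       p = ≐-trans (proj₁ (full-iff p) (≐-sym full≐⟦[]⟧)) full≐⟦[]⟧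
      app-⟦⟧ {suc n} (a ∷ as) p = begin
        app ⟦ a ∷ as ⟧ p
          ≈⟨ app-≐ p q (≐-sym (⟦⟧-++ (a ∷ []) as)) ⟩
        app (⟦ a ∷ [] ⟧ ⊗ ⟦ as ⟧) q
          ≈⟨ pres-⊗ (tot a) (⟦⟧∈dom as) q ⟩
        app ⟦ a ∷ [] ⟧ (tot a) ⊗ app ⟦ as ⟧ (⟦⟧∈dom as)
          ≈⟨ ⊗-cong (π-spec a) (app-⟦⟧ as (⟦⟧∈dom as)) ⟩
        ⟦ π a ∷ [] ⟧ ⊗ ⟦ map π as ⟧
          ≈⟨ ⟦⟧-++ (π a ∷ []) (map π as) ⟩
        ⟦ π a ∷ map π as ⟧
          ∎
        where
        open SetoidReasoning (≐-setoid {B} {suc n})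
        q = dom-cl _ _ (cl-⊗ (cl-base (tot a)) (cl-base (⟦⟧∈dom as)))

      ∈-app : ∀ {n} {X : NRel A n} (p : dom n X) {a} → X a → app X p (map π a)
      ∈-app p {a} Xa =
        proj₁ (⊆-iff (⟦⟧∈dom a) p) (∈⇒⟦⟧⊆ Xa) (map π a) (proj₂ (app-⟦⟧ a _) _ refl)

      ∈-app⁻ : ∀ {n} {X : NRel A n} (p : dom n X) {a} → app X p (map π a) → X a
      ∈-app⁻ {X = X} p {a} πa∈fX = proj₂ (⊆-iff (⟦⟧∈dom a) p) f⟦a⟧⊆fX a refl
        where
        f⟦a⟧⊆fX : app ⟦ a ⟧ (⟦⟧∈dom a) ⊆ᵣ app X p
        f⟦a⟧⊆fX v v∈f⟦a⟧ = subst (app X p) (sym (proj₁ (app-⟦⟧ a _) v v∈f⟦a⟧)) πa∈fX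

      π-injective : Injective _≡_ _≡_ π
      π-injective {x} {y} πx≡πy = ∷-injectiveˡ (∈-app⁻ (tot y) πx∈f⟦y⟧)
        where
        πx∈f⟦y⟧ : app ⟦ y ∷ [] ⟧ (tot y) (π x ∷ [])
        πx∈f⟦y⟧ = subst (λ b → app ⟦ y ∷ [] ⟧ (tot y) (b ∷ [])) (sym πx≡πy) (∈-app (tot y) refl)

      module _ (surj : ElementSurjective f) where

        π-strictlySurjective : StrictlySurjective _≡_ π
        π-strictlySurjective b with surj b
        ... | X , p , fX≐⟦b⟧ with proj₂ (single-iff p) (b ∷ [] , fX≐⟦b⟧)
        ... | a ∷ [] , X≐⟦a⟧ = a , ∷-injectiveˡ (proj₁ fX≐⟦b⟧ _ (∈-app p (proj₂ X≐⟦a⟧ _ refl)))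

        f⊆hatπ : f ⊆hat π
        f⊆hatπ n X p = fX⊆hatX , λ { _ (a , Xa , refl) → ∈-app p Xa }
          where
          fX⊆hatX : app X p ⊆ᵣ hat π X
          fX⊆hatX w w∈fX with map-strictlySurjective π-strictlySurjective w
          ... | a , refl = a , ∈-app⁻ p w∈fX , refl

        hat≐ : ∀ {n} {X : NRel A n} {Y} → Cl M dom n X →
               ((p : dom n X) → app X p ≐ Y) → hat π X ≐ Y
        hat≐ X∈cl fX≐Y = ≐-trans (≐-sym (f⊆hatπ _ _ p)) (fX≐Y p)
          where p = dom-cl _ _ X∈cl

        π-isomorphism : IsIsomorphism M N π
        π-isomorphism = hat-isomorphism M N
          (π-injective , strictlySurjective⇒surjective π-strictlySurjective)
          (λ R → hat≐ (cl-rel R) (pres-rel R))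
          (λ F → hat≐ (cl-graph F) (pres-graph F))
          (λ c → hat≐ (cl-const c) (pres-const c))

mainTheorem9 : {σ : Signature} {M N : Structure σ} (f : PartialTeamMap M N) →
               IsPartialTeamIso f → ElementTotal f → ElementSurjective f →
               Σ (Structure.Carrier M → Structure.Carrier N)
                 λ π → IsIsomorphism M N π × (f ⊆hat π)
mainTheorem9 f iso tot surj =
  π f tot iso , π-isomorphism f tot iso surj , f⊆hatπ f tot iso surj
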